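{- Let $n\ge 1$ and $k\ge1$ be integers and let $G$ be a complete graph with $|G|\ge 2n+1$ whose edges are colored by a Gallai $k$-coloring $c$. Let $V_1,\ldots,V_p$ be a Gallai partition of $G$ under $c$, and let $V$ be a largest part of this partition. If $|V|\le n$ and all the edges of $G$ joining vertices in different parts are colored by the same color, say blue, then $G$ contains a blue cycle $C_{2n+1}$.
   Context: A Gallai coloring of a complete graph is an edge-coloring with no rainbow triangle (a triangle whose three edges receive three distinct colors); a Gallai $k$-coloring is a Gallai coloring using $k$ colors. For a Gallai coloring $c$ of a complete graph $G$, a Gallai partition is a partition of $V(G)$ into nonempty sets $V_1,\ldots,V_p$ with $p>1$ such that at most two colors are used on the edges joining vertices in different parts, and for each pair $i\ne j$ all edges between $V_i$ and $V_j$ receive a single color. $C_m$ denotes the cycle on $m$ vertices. -}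

module Defs where

open import Data.Nat using (ℕ; zero; suc; _+_; _*_; _≤_; _<_)
open import Data.Fin using (Fin; toℕ; fromℕ<)
open import Data.Fin.Properties using () renaming (_≟_ to _≟ᶠ_)
open import Data.List using (List; length; filter; allFin)
open import Data.Product using (Σ; ∃; _×_; _,_)
open import Data.Sum using (_⊎_)
open import Data.Nat.DivMod using (_%_; m%n<n)
open import Relation.Binary.PropositionalEquality using (_≡_; _≢_)
open import Relation.Nullary using (¬_)
open import Function.Definitions using (Injective)

-- An edge-colouring of the complete graph on vertex set Fin N with colours Fin k:
-- a colour for every ordered pair, symmetric on pairs of distinct vertices
-- (values on the diagonal are irrelevant).
Colouring : ℕ → ℕ → Set
Colouring N k = Fin N → Fin N → Fin k

Symmetric : ∀ {N k} → Colouring N k → Set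
Symmetric {N} c = (x y : Fin N) → x ≢ y → c x y ≡ c y x

RainbowTriangle : ∀ {N k} → Colouring N k → Fin N → Fin N → Fin N → Set
RainbowTriangle c x y z =
  x ≢ y × y ≢ z × x ≢ z × c x y ≢ c y z × c y z ≢ c x z × c x y ≢ c x z

Gallai : ∀ {N k} → Colouring N k → Set
Gallai {N} c = (x y z : Fin N) → ¬ RainbowTriangle c x y z

partSize : ∀ {N p} → (Fin N → Fin p) → Fin p → ℕ
partSize {N} part i = length (filter (λ x → part x ≟ᶠ i) (allFin N))

record GallaiPartition {N k p : ℕ} (c : Colouring N k) (part : Fin N → Fin p) : Set where
  field
    manyParts   : 1 < p
    nonempty    : (i : Fin p) → ∃ λ x → part x ≡ i
    monoBetween : (x x' y y' : Fin N) → part x ≡ part x' → part y ≡ part y' →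
                  part x ≢ part y → c x y ≡ c x' y'
    twoColours  : ∃ λ (a : Fin k) → ∃ λ (b : Fin k) → (x y : Fin N) →
                  part x ≢ part y → (c x y ≡ a) ⊎ (c x y ≡ b)

-- successor modulo m on Fin m (m ≥ 1 is automatic since Fin m is inhabited)
cycSuc : ∀ {m} → Fin m → Fin m
cycSuc {suc m} i = fromℕ< (m%n<n (suc (toℕ i)) (suc m))

MonoCycle : ∀ {N k} → Colouring N k → Fin k → ℕ → Set
MonoCycle {N} c b m = Σ (Fin m → Fin N) λ v →
  Injective _≡_ _≡_ v × ((i : Fin m) → c (v i) (v (cycSuc i)) ≡ b)

-- Only the blue edges between parts and the bound on the part sizes matter.
-- List the vertices part by part (the list `ordering`).  Since each part occupies
-- a contiguous segment of length at most n, two entries at list distance at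
-- least n lie in different parts, so they are joined by a blue edge; we call
-- such a list n-spread.  The first 2n+1 entries of an n-spread list of distinct
-- vertices are visited in the zigzag order
--     0, n+1, 1, n+2, 2, ..., n-1, 2n, n
-- in which consecutive positions, including the closing pair (n, 0), are at
-- distance at least n; this gives the blue cycle.

module Submission where

open import Defs
open import Data.Nat using (ℕ; _+_; _*_; _≤_)
open import Data.Fin using (Fin)
open import Relation.Binary.PropositionalEquality using (_≡_; _≢_)

open import Data.Nat using (zero; suc; _<_; z≤n; s≤s; _<?_)
open import Data.Nat.Properties
open import Data.Nat.DivMod using (_%_; m%n<n; n%n≡0; m<n⇒m%n≡m)
open import Data.Fin using (toℕ; fromℕ<)
open import Data.Fin.Properties using (toℕ-injective; toℕ-fromℕ<; toℕ<n; injective⇒≤)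
  renaming (_≟_ to _≟ᶠ_)
open import Data.List using (List; []; _∷_; _++_; length; lookup; filter; allFin; concatMap)
open import Data.List.Properties using (length-++)
open import Data.List.Relation.Unary.All as All using (All)
open import Data.List.Relation.Unary.Any as Any using (here; there)
open import Data.List.Relation.Unary.Any.Properties using (lookup-index)
open import Data.List.Relation.Unary.AllPairs using ([]; _∷_)
open import Data.List.Relation.Unary.Unique.Propositional using (Unique)
open import Data.List.Relation.Unary.Unique.Propositional.Properties using (filter⁺; allFin⁺; ++⁺)
open import Data.List.Membership.Propositional using (_∈_)
open import Data.List.Membership.Propositional.Properties
  using (∈-filter⁺; ∈-filter⁻; ∈-allFin; ∈-concatMap⁺; ∈-concatMap⁻)
open import Data.Product using (_×_; _,_; proj₂)
open import Data.Sum using (_⊎_; inj₁; inj₂)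
open import Data.Empty using (⊥-elim)
open import Relation.Nullary using (yes; no)
open import Relation.Binary.PropositionalEquality using (refl; sym; trans; cong; subst)

-- The entry of a list at a natural-number position, with a default value
-- for positions out of range; positions are then plain arithmetic.
nth : {A : Set} → A → List A → ℕ → A
nth d []       _       = d
nth d (x ∷ xs) zero    = x
nth d (x ∷ xs) (suc a) = nth d xs a

nth-++ˡ : {A : Set} (d : A) (xs ys : List A) {a : ℕ} →
          a < length xs → nth d (xs ++ ys) a ≡ nth d xs a
nth-++ˡ d (x ∷ xs) ys {zero}  _         = refl
nth-++ˡ d (x ∷ xs) ys {suc a} (s≤s a<) = nth-++ˡ d xs ys a<

nth-++ʳ : {A : Set} (d : A) (xs ys : List A) (a : ℕ) →
          nth d (xs ++ ys) (length xs + a) ≡ nth d ys a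
nth-++ʳ d []       ys a = refl
nth-++ʳ d (x ∷ xs) ys a = nth-++ʳ d xs ys a

nth-∈ : {A : Set} (d : A) {xs : List A} {a : ℕ} → a < length xs → nth d xs a ∈ xs
nth-∈ d {x ∷ xs} {zero}  _         = here refl
nth-∈ d {x ∷ xs} {suc a} (s≤s a<) = there (nth-∈ d a<)

nth-injective : {A : Set} (d : A) {xs : List A} → Unique xs → {a b : ℕ} →
                a < length xs → b < length xs → nth d xs a ≡ nth d xs b → a ≡ b
nth-injective d _          {zero}  {zero}  _         _         _  = refl
nth-injective d (x∉ ∷ _)   {zero}  {suc b} _         (s≤s b<) eq = ⊥-elim (All.lookup x∉ (nth-∈ d b<) eq)
nth-injective d (x∉ ∷ _)   {suc a} {zero}  (s≤s a<) _         eq = ⊥-elim (All.lookup x∉ (nth-∈ d a<) (sym eq))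
nth-injective d (_ ∷ uniq) {suc a} {suc b} (s≤s a<) (s≤s b<) eq = cong suc (nth-injective d uniq a< b< eq)

-- A list containing every element of Fin N has length at least N:
-- sending an element to the index of its occurrence is injective.
covering-length : {N : ℕ} (xs : List (Fin N)) → ((x : Fin N) → x ∈ xs) → N ≤ length xs
covering-length xs covers = injective⇒≤ position-injective
  where
  position : Fin _ → Fin (length xs)
  position x = Any.index (covers x)
  position-injective : {x y : Fin _} → position x ≡ position y → x ≡ y
  position-injective {x} {y} eq =
    trans (lookup-index (covers x)) (trans (cong (lookup xs) eq) (sym (lookup-index (covers y))))

data Offset (m : ℕ) : ℕ → Set where
  inside : {k : ℕ} → k < m → Offset m k
  beyond : (k : ℕ) → Offset m (m + k)

offset : (m k : ℕ) → Offset m k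
offset zero    k       = beyond k
offset (suc m) zero    = inside (s≤s z≤n)
offset (suc m) (suc k) with offset m k
... | inside k<m = inside (s≤s k<m)
... | beyond k'  = beyond k'

Far : ℕ → ℕ → ℕ → Set
Far n a b = (a + n ≤ b) ⊎ (b + n ≤ a)

module Spreading {A B : Set} (part : A → B) (n : ℕ) (d : A) where

  Spread : List A → Set
  Spread xs = (a b : ℕ) → a + n ≤ b → b < length xs → part (nth d xs a) ≢ part (nth d xs b)

  spread-[] : Spread []
  spread-[] _ _ _ ()

  -- Two far positions cannot both lie
  -- in the block (it is shorter than n); one in the block and one beyond lie in
  -- part i and outside it; two beyond reduce to the spread of xs.
  spread-++ : (i : B) (bs xs : List A) → length bs ≤ n →
              ({x : A} → x ∈ bs → part x ≡ i) → ({x : A} → x ∈ xs → part x ≢ i) →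
              Spread xs → Spread (bs ++ xs)
  spread-++ i bs xs short inBlock avoids spread a b a+n≤b b<len
    with offset (length bs) a | offset (length bs) b
  ... | inside a<  | inside b< =
    ⊥-elim (<⇒≱ (≤-trans b< short) (≤-trans (m≤n+m n a) a+n≤b))
  ... | inside a<  | beyond b' = λ same → second-avoids-i (trans (sym same) first-in-i)
    where
    first-in-i : part (nth d (bs ++ xs) a) ≡ i
    first-in-i = trans (cong part (nth-++ˡ d bs xs a<)) (inBlock (nth-∈ d a<))
    b'< : b' < length xs
    b'< = +-cancelˡ-< (length bs) b' (length xs) (subst (length bs + b' <_) (length-++ bs) b<len)
    second-avoids-i : part (nth d (bs ++ xs) (length bs + b')) ≢ i
    second-avoids-i rewrite nth-++ʳ d bs xs b' = avoids (nth-∈ d b'<)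
  ... | beyond a'  | inside b< =
    ⊥-elim (<⇒≱ b< (≤-trans (≤-trans (m≤m+n (length bs) a') (m≤m+n _ n)) a+n≤b))
  ... | beyond a'  | beyond b'
    rewrite nth-++ʳ d bs xs a' | nth-++ʳ d bs xs b' =
    spread a' b' (+-cancelˡ-≤ (length bs) _ _ (subst (_≤ length bs + b') (+-assoc (length bs) a' n) a+n≤b))
                 (+-cancelˡ-< (length bs) b' _ (subst (length bs + b' <_) (length-++ bs) b<len))

  spread-far : {xs : List A} → Spread xs → {a b : ℕ} → a < length xs → b < length xs →
               Far n a b → part (nth d xs a) ≢ part (nth d xs b)
  spread-far spread a< b< (inj₁ a+n≤b) = spread _ _ a+n≤b b<
  spread-far spread a< b< (inj₂ b+n≤a) = λ eq → spread _ _ b+n≤a a< (sym eq)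

module Ordering {N p : ℕ} (part : Fin N → Fin p) where

  block : Fin p → List (Fin N)
  block i = filter (λ x → part x ≟ᶠ i) (allFin N)

  ∈-block⁻ : {i : Fin p} {x : Fin N} → x ∈ block i → part x ≡ i
  ∈-block⁻ {i} x∈ = proj₂ (∈-filter⁻ (λ y → part y ≟ᶠ i) {xs = allFin N} x∈)

  ∈-block⁺ : (x : Fin N) → x ∈ block (part x)
  ∈-block⁺ x = ∈-filter⁺ (λ y → part y ≟ᶠ part x) (∈-allFin x) refl

  grouped : List (Fin p) → List (Fin N)
  grouped = concatMap block

  ∈-grouped⁻ : {is : List (Fin p)} {x : Fin N} → x ∈ grouped is → part x ∈ is
  ∈-grouped⁻ x∈ = Any.map ∈-block⁻ (∈-concatMap⁻ block x∈)

  ∈-grouped⁺ : {is : List (Fin p)} (x : Fin N) → part x ∈ is → x ∈ grouped is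
  ∈-grouped⁺ x px∈ = ∈-concatMap⁺ block (Any.map (λ { refl → ∈-block⁺ x }) px∈)

  unique-grouped : {is : List (Fin p)} → Unique is → Unique (grouped is)
  unique-grouped {[]}     _          = []
  unique-grouped {i ∷ is} (i∉ ∷ uniq) =
    ++⁺ (filter⁺ (λ x → part x ≟ᶠ i) (allFin⁺ N)) (unique-grouped uniq)
        (λ (x∈b , x∈g) → All.lookup i∉ (∈-grouped⁻ x∈g) (sym (∈-block⁻ x∈b)))

  spread-grouped : (n : ℕ) (d : Fin N) → ((i : Fin p) → partSize part i ≤ n) →
                   {is : List (Fin p)} → Unique is → Spreading.Spread part n d (grouped is)
  spread-grouped n d small {[]}     _           = Spreading.spread-[] part n d
  spread-grouped n d small {i ∷ is} (i∉ ∷ uniq) =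
    Spreading.spread-++ part n d i (block i) (grouped is) (small i) ∈-block⁻
      (λ x∈ px≡i → All.lookup i∉ (∈-grouped⁻ x∈) (sym px≡i))
      (spread-grouped n d small uniq)

  ordering : List (Fin N)
  ordering = grouped (allFin p)

  unique-ordering : Unique ordering
  unique-ordering = unique-grouped (allFin⁺ p)

  length-ordering : N ≤ length ordering
  length-ordering = covering-length ordering (λ x → ∈-grouped⁺ x (∈-allFin (part x)))

zigzag : ℕ → ℕ → ℕ
zigzag n zero          = zero
zigzag n (suc zero)    = suc n
zigzag n (suc (suc t)) = suc (zigzag n t)

data Parity : ℕ → Set where
  even : (i : ℕ) → Parity (i + i)
  odd  : (i : ℕ) → Parity (suc (i + i))

parity : (t : ℕ) → Parity t
parity zero = even zero
parity (suc t) with parity t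
... | even i = odd i
... | odd i  = subst Parity (cong suc (+-suc i i)) (even (suc i))

zigzag-even : (n i : ℕ) → zigzag n (i + i) ≡ i
zigzag-even n zero    = refl
zigzag-even n (suc i) rewrite +-suc i i = cong suc (zigzag-even n i)

zigzag-odd : (n i : ℕ) → zigzag n (suc (i + i)) ≡ suc (n + i)
zigzag-odd n zero    = cong suc (sym (+-identityʳ n))
zigzag-odd n (suc i) rewrite +-suc i i | zigzag-odd n i | +-suc n i = refl

half-≤ : {i n : ℕ} → i + i ≤ n + n → i ≤ n
half-≤ h = ≮⇒≥ (λ n<i → <⇒≱ (+-mono-< n<i n<i) h)

half-< : {i n : ℕ} → suc (i + i) ≤ n + n → i < n
half-< h = ≰⇒> (λ n≤i → <⇒≱ h (+-mono-≤ n≤i n≤i))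

zigzag-bound : (n t : ℕ) → t ≤ n + n → zigzag n t ≤ n + n
zigzag-bound n t h with parity t
... | even i rewrite zigzag-even n i = ≤-trans (m≤m+n i i) h
... | odd i  rewrite zigzag-odd n i  = +-monoʳ-< n (half-< h)

zigzag-injective : (n t t' : ℕ) → t ≤ n + n → t' ≤ n + n → zigzag n t ≡ zigzag n t' → t ≡ t'
zigzag-injective n t t' h h' eq with parity t | parity t'
... | even i | even j rewrite zigzag-even n i | zigzag-even n j = cong (λ z → z + z) eq
... | odd i  | odd j  rewrite zigzag-odd n i  | zigzag-odd n j  =
  cong (λ z → suc (z + z)) (+-cancelˡ-≡ n i j (suc-injective eq))
... | even i | odd j  rewrite zigzag-even n i | zigzag-odd n j  =
  ⊥-elim (<⇒≱ (subst (n <_) (sym eq) (s≤s (m≤m+n n j))) (half-≤ h))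
... | odd i  | even j rewrite zigzag-odd n i  | zigzag-even n j =
  ⊥-elim (<⇒≱ (subst (n <_) eq (s≤s (m≤m+n n i))) (half-≤ h'))

zigzag-far : (n t : ℕ) → Far n (zigzag n t) (zigzag n (suc t))
zigzag-far n t with parity t
... | even i rewrite zigzag-even n i | zigzag-odd n i = inj₁ (≤-trans (≤-reflexive (+-comm i n)) (n≤1+n _))
... | odd i  rewrite zigzag-even n i | zigzag-odd n i = inj₂ (s≤s (≤-reflexive (+-comm i n)))

cycSuc-toℕ : (m : ℕ) (k : Fin (suc m)) →
             (toℕ (cycSuc k) ≡ suc (toℕ k)) ⊎ (toℕ k ≡ m × toℕ (cycSuc k) ≡ 0)
cycSuc-toℕ m k with toℕ k <? m
... | yes k<m = inj₁ (trans (toℕ-fromℕ< (m%n<n (suc (toℕ k)) (suc m))) (m<n⇒m%n≡m (s≤s k<m)))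
... | no  k≮m = inj₂ (k≡m , trans (toℕ-fromℕ< (m%n<n (suc (toℕ k)) (suc m)))
                                  (trans (cong (λ z → suc z % suc m) k≡m) (n%n≡0 (suc m))))
  where
  k≡m : toℕ k ≡ m
  k≡m = ≤-antisym (≤-pred (toℕ<n k)) (≮⇒≥ k≮m)

zigzag-far-cyclic : (n : ℕ) (k : Fin (suc (n + n))) →
                    Far n (zigzag n (toℕ k)) (zigzag n (toℕ (cycSuc k)))
zigzag-far-cyclic n k with cycSuc-toℕ (n + n) k
... | inj₁ next rewrite next = zigzag-far n (toℕ k)
... | inj₂ (last , first) rewrite last | first = inj₂ (≤-reflexive (sym (zigzag-even n n)))

zigzagCycle : {N k p : ℕ} (n : ℕ) (c : Colouring N k) (part : Fin N → Fin p) (blue : Fin k) →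
              ((x y : Fin N) → part x ≢ part y → c x y ≡ blue) →
              (d : Fin N) (xs : List (Fin N)) → Unique xs → Spreading.Spread part n d xs →
              suc (n + n) ≤ length xs → MonoCycle c blue (suc (n + n))
zigzagCycle n c part blue crossBlue d xs uniq spread long = vertex , vertex-injective , vertex-blue
  where
  position : Fin (suc (n + n)) → ℕ
  position k = zigzag n (toℕ k)

  in-range : (k : Fin (suc (n + n))) → position k < length xs
  in-range k = ≤-trans (s≤s (zigzag-bound n (toℕ k) (≤-pred (toℕ<n k)))) long

  vertex : Fin (suc (n + n)) → Fin _
  vertex k = nth d xs (position k)

  vertex-injective : {k k' : Fin (suc (n + n))} → vertex k ≡ vertex k' → k ≡ k'
  vertex-injective {k} {k'} eq =
    toℕ-injective (zigzag-injective n (toℕ k) (toℕ k') (≤-pred (toℕ<n k)) (≤-pred (toℕ<n k'))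
                    (nth-injective d uniq (in-range k) (in-range k') eq))

  vertex-blue : (k : Fin (suc (n + n))) → c (vertex k) (vertex (cycSuc k)) ≡ blue
  vertex-blue k = crossBlue _ _
    (Spreading.spread-far part n d {xs} spread (in-range k) (in-range (cycSuc k)) (zigzag-far-cyclic n k))

lemma4p1 : (n k N p : ℕ) → 1 ≤ n → 1 ≤ k → 2 * n + 1 ≤ N →
    (c : Colouring N k) → Symmetric c → Gallai c →
    (part : Fin N → Fin p) → GallaiPartition c part →
    (V : Fin p) → ((i : Fin p) → partSize part i ≤ partSize part V) →
    partSize part V ≤ n →
    (blue : Fin k) → ((x y : Fin N) → part x ≢ part y → c x y ≡ blue) →
    MonoCycle c blue (2 * n + 1)
lemma4p1 n k N p _ _ 2n+1≤N c _ _ part _ V maxV V≤n blue crossBlue =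
  subst (MonoCycle c blue) (sym 2n+1≡) cycle
  where
  open Ordering part
  2n+1≡ : 2 * n + 1 ≡ suc (n + n)
  2n+1≡ = trans (+-comm (2 * n) 1) (cong (λ z → suc (n + z)) (+-identityʳ n))
  small : (i : Fin p) → partSize part i ≤ n
  small i = ≤-trans (maxV i) V≤n
  d : Fin N
  d = fromℕ< (≤-trans (m≤n+m 1 (2 * n)) 2n+1≤N)
  cycle : MonoCycle c blue (suc (n + n))
  cycle = zigzagCycle n c part blue crossBlue d ordering unique-ordering
            (spread-grouped n d small (allFin⁺ p))
            (≤-trans (subst (_≤ N) 2n+1≡ 2n+1≤N) length-ordering)
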